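{- Let $\mathcal C\subseteq 2^{[n]}$ be an intersection-complete neural code and let $i\in[n]$ be a non-redundant, nontrivial neuron. Let $\mu$ be the minimal element of $\mathrm{Tk}_{\mathcal C}(i)$, and let $f:\mathcal C\to\mathcal C^{(i)}$ be the natural surjective morphism. Then (i) $\mu\setminus\{i\}\in\mathcal C$, and (ii) $f(\mu)=f(\mu\setminus\{i\})$.
   Context: A neural code is a set $\mathcal C\subseteq 2^{[n]}$ containing $\varnothing$. For $\sigma\subseteq[n]$, the trunk $\mathrm{Tk}_{\mathcal C}(\sigma)=\{\tau\in\mathcal C:\sigma\subseteq\tau\}$. A code is intersection-complete if closed under pairwise intersection (so a nonempty trunk has a minimal element, the intersection of its elements). A neuron $i$ is trivial if $\mathrm{Tk}_{\mathcal C}(i):=\mathrm{Tk}_{\mathcal C}(\{i\})=\varnothing$, and redundant if $\mathrm{Tk}_{\mathcal C}(i)=\mathrm{Tk}_{\mathcal C}(\sigma)$ for some $\sigma\subseteq[n]\setminus\{i\}$. Given trunks $T_1,\dots,T_m$ in $\mathcal C$, the morphism determined by them is $c\mapsto\{j\in[m]:c\in T_j\}$. With $T_j=\mathrm{Tk}_{\mathcal C}(j)$, the $i$th covered code $\mathcal C^{(i)}$ is the image of $\mathcal C$ under the morphism determined by (an indexing of) the collection $\{T_j: T_j\neq T_i\}\cup\{T_j\cap T_i: T_j\cap T_i\neq T_i\}$, and the natural surjective morphism $f:\mathcal C\to\mathcal C^{(i)}$ is this map with codomain $\mathcal C^{(i)}$. -}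

module Defs where

open import Data.Nat using (ℕ)
open import Data.Fin using (Fin)
open import Data.Fin.Subset using (Subset; ⁅_⁆; _∈_; _∉_; _⊆_; _∩_; _-_; ⊥)
open import Data.List using (List)
import Data.List.Membership.Propositional as LM
open import Data.Product using (_×_; Σ; ∃)
open import Data.Sum using (_⊎_; inj₁; inj₂)
open import Function.Bundles using (_⇔_)
open import Relation.Nullary using (¬_)

CodeOn : ℕ → Set
CodeOn n = List (Subset n)

_∈C_ : ∀ {n} → Subset n → CodeOn n → Set
c ∈C C = LM._∈_ c C

IsNeuralCode : ∀ {n} → CodeOn n → Set
IsNeuralCode C = ⊥ ∈C C

IntersectionComplete : ∀ {n} → CodeOn n → Set
IntersectionComplete C = ∀ a b → a ∈C C → b ∈C C → (a ∩ b) ∈C C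

Tk : ∀ {n} → CodeOn n → Subset n → Subset n → Set
Tk C σ τ = τ ∈C C × σ ⊆ τ

Tk₁ : ∀ {n} → CodeOn n → Fin n → Subset n → Set
Tk₁ C i = Tk C ⁅ i ⁆

SameSet : ∀ {n} → (Subset n → Set) → (Subset n → Set) → Set
SameSet P Q = ∀ τ → P τ ⇔ Q τ

_∩T_ : ∀ {n} → (Subset n → Set) → (Subset n → Set) → Subset n → Set
(P ∩T Q) τ = P τ × Q τ

Trivial : ∀ {n} → CodeOn n → Fin n → Set
Trivial C i = ∀ τ → ¬ Tk₁ C i τ

Redundant : ∀ {n} → CodeOn n → Fin n → Set
Redundant C i = Σ (Subset _) λ σ → i ∉ σ × SameSet (Tk₁ C i) (Tk C σ)

IsMinimalOfTrunk : ∀ {n} → CodeOn n → Fin n → Subset n → Set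
IsMinimalOfTrunk C i μ = Tk₁ C i μ × (∀ τ → Tk₁ C i τ → μ ⊆ τ)

-- Indexing of the collection
--   {T_j : T_j ≠ T_i} ∪ {T_j ∩ T_i : T_j ∩ T_i ≠ T_i}
-- by Fin n ⊎ Fin n: inj₁ j stands for T_j (present iff T_j ≠ T_i),
-- inj₂ j stands for T_j ∩ T_i (present iff T_j ∩ T_i ≠ T_i).
-- CoveredIndex C i k c  says: index k belongs to the collection and
-- c lies in the trunk indexed by k, i.e. k ∈ f(c).
CoveredIndex : ∀ {n} → CodeOn n → Fin n → Fin n ⊎ Fin n → Subset n → Set
CoveredIndex C i (inj₁ j) c =
  ¬ SameSet (Tk₁ C j) (Tk₁ C i) × Tk₁ C j c
CoveredIndex C i (inj₂ j) c =
  ¬ SameSet (Tk₁ C j ∩T Tk₁ C i) (Tk₁ C i) × (Tk₁ C j ∩T Tk₁ C i) c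

SameImage : ∀ {n} → CodeOn n → Fin n → Subset n → Subset n → Set
SameImage C i a b = ∀ k → CoveredIndex C i k a ⇔ CoveredIndex C i k b

{-# OPTIONS --safe #-}

-- Write σ = μ - i.  If σ ∉ C, every codeword τ ⊇ σ contains i, for otherwise
-- τ ∩ μ = σ would be a codeword; so Tk(i) = Tk(σ) and i would be redundant.
-- Since μ and σ differ only at i, they lie in the same trunks T_j (j ≠ i).
-- Neither lies in a trunk T_j ∩ T_i ≠ T_i of the collection: σ misses i, and
-- if j ∈ μ then every member of T_i contains μ, hence j, so T_j ∩ T_i = T_i.
module Submission where

open import Defs
open import Data.Bool.Properties using () renaming (_≟_ to _≟ᵇ_)
open import Data.Nat using (ℕ)
open import Data.Fin using (Fin; _≟_)
open import Data.Fin.Subset using (Subset; _-_; _─_; _∈_; _∉_; _⊆_; _∩_; ⁅_⁆; outside)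
open import Data.Fin.Subset.Properties
  using (x∈⁅x⁆; x∈⁅y⁆⇒x≡y; p─q⊆p; x∈p∧x≢y⇒x∈p-y; ⊆-antisym; x∈p∩q⁺; x∈p∩q⁻; _∈?_)
import Data.List.Membership.DecPropositional as DecMembership
open import Data.Product using (_×_; _,_; proj₁; proj₂)
open import Data.Sum using (inj₁; inj₂)
open import Data.Vec using (_∷_; here; there)
open import Data.Vec.Properties using (≡-dec)
open import Function.Bundles using (_⇔_; mk⇔)
open import Function.Construct.Identity using (⇔-id)
open import Relation.Binary.Definitions using (DecidableEquality)
open import Relation.Binary.PropositionalEquality using (_≡_; refl; sym; subst)
open import Relation.Nullary using (¬_; yes; no; contradiction)

¬-both⇒⇔ : ∀ {a b} {A : Set a} {B : Set b} → ¬ A → ¬ B → A ⇔ B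
¬-both⇒⇔ ¬a ¬b = mk⇔ (λ a → contradiction a ¬a) (λ b → contradiction b ¬b)

x∈p─q⇒x∉q : ∀ {n} {x : Fin n} (p q : Subset n) → x ∈ p ─ q → x ∉ q
x∈p─q⇒x∉q (_ ∷ p) (outside ∷ q) here ()
x∈p─q⇒x∉q (_ ∷ p) (_ ∷ q) (there x∈p─q) (there x∈q) = x∈p─q⇒x∉q p q x∈p─q x∈q

module _ {n : ℕ} where

  _≟ₛ_ : DecidableEquality (Subset n)
  _≟ₛ_ = ≡-dec _≟ᵇ_

  x∈p⇒⁅x⁆⊆p : ∀ {x : Fin n} {p} → x ∈ p → ⁅ x ⁆ ⊆ p
  x∈p⇒⁅x⁆⊆p {x} {p} x∈p y∈⁅x⁆ = subst (_∈ p) (sym (x∈⁅y⁆⇒x≡y x y∈⁅x⁆)) x∈p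

  x∉p-x : ∀ (p : Subset n) x → x ∉ p - x
  x∉p-x p x x∈p-x = x∈p─q⇒x∉q p ⁅ x ⁆ x∈p-x (x∈⁅x⁆ x)

  p-x⊆q∧x∉q⇒q∩p≡p-x : ∀ {p q : Subset n} {x} → p - x ⊆ q → x ∉ q → q ∩ p ≡ p - x
  p-x⊆q∧x∉q⇒q∩p≡p-x {p} {q} {x} p-x⊆q x∉q = ⊆-antisym q∩p⊆p-x p-x⊆q∩p
    where
    q∩p⊆p-x : q ∩ p ⊆ p - x
    q∩p⊆p-x y∈q∩p with x∈p∩q⁻ q p y∈q∩p
    ... | y∈q , y∈p = x∈p∧x≢y⇒x∈p-y y∈p (λ { refl → x∉q y∈q })

    p-x⊆q∩p : p - x ⊆ q ∩ p
    p-x⊆q∩p y∈p-x = x∈p∩q⁺ (p-x⊆q y∈p-x , p─q⊆p p ⁅ x ⁆ y∈p-x)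

module _ {n : ℕ} {C : CodeOn n} where

  open DecMembership (_≟ₛ_ {n}) using () renaming (_∈?_ to _∈C?_)

  Tk₁-intro : ∀ {j c} → c ∈C C → j ∈ c → Tk₁ C j c
  Tk₁-intro c∈C j∈c = c∈C , x∈p⇒⁅x⁆⊆p j∈c

  Tk₁-neuron : ∀ {j c} → Tk₁ C j c → j ∈ c
  Tk₁-neuron {j} (_ , ⁅j⁆⊆c) = ⁅j⁆⊆c (x∈⁅x⁆ j)

  ¬CoveredIndex-own : ∀ {i c} → ¬ CoveredIndex C i (inj₁ i) c
  ¬CoveredIndex-own (Tᵢ≢Tᵢ , _) = Tᵢ≢Tᵢ (λ _ → ⇔-id _)

  ¬CoveredIndex-∩-outside : ∀ {i c} j → i ∉ c → ¬ CoveredIndex C i (inj₂ j) c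
  ¬CoveredIndex-∩-outside j i∉c (_ , (_ , c∈Tᵢ)) = i∉c (Tk₁-neuron c∈Tᵢ)

  CoveredIndex-mono : ∀ {i j a b} → b ∈C C → (j ∈ a → j ∈ b) →
                      CoveredIndex C i (inj₁ j) a → CoveredIndex C i (inj₁ j) b
  CoveredIndex-mono b∈C j∈a⇒j∈b (Tⱼ≢Tᵢ , a∈Tⱼ) =
    Tⱼ≢Tᵢ , Tk₁-intro b∈C (j∈a⇒j∈b (Tk₁-neuron a∈Tⱼ))

  module _ {i : Fin n} {μ : Subset n} (minimal : IsMinimalOfTrunk C i μ) where

    μ-i∉C⇒Tk₁≡Tk[μ-i] : IntersectionComplete C → ¬ (μ - i) ∈C C →
                        SameSet (Tk₁ C i) (Tk C (μ - i))
    μ-i∉C⇒Tk₁≡Tk[μ-i] closed μ-i∉C τ = mk⇔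
      (λ τ∈Tkᵢ → proj₁ τ∈Tkᵢ , λ {x} x∈μ-i → proj₂ minimal τ τ∈Tkᵢ (p─q⊆p μ ⁅ i ⁆ x∈μ-i))
      (λ τ∈Tk → Tk₁-intro (proj₁ τ∈Tk) (i∈τ τ τ∈Tk))
      where
      i∈τ : ∀ τ → Tk C (μ - i) τ → i ∈ τ
      i∈τ τ (τ∈C , μ-i⊆τ) with i ∈? τ
      ... | yes i∈τ = i∈τ
      ... | no i∉τ  = contradiction
        (subst (_∈C C) (p-x⊆q∧x∉q⇒q∩p≡p-x μ-i⊆τ i∉τ)
               (closed τ μ τ∈C (proj₁ (proj₁ minimal))))
        μ-i∉C

    ¬redundant⇒μ-i∈C : IntersectionComplete C → ¬ Redundant C i → (μ - i) ∈C C
    ¬redundant⇒μ-i∈C closed ¬redundant with (μ - i) ∈C? C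
    ... | yes μ-i∈C = μ-i∈C
    ... | no μ-i∉C  = contradiction
      (μ - i , x∉p-x μ i , μ-i∉C⇒Tk₁≡Tk[μ-i] closed μ-i∉C) ¬redundant

    ¬CoveredIndex-∩-μ : ∀ j → ¬ CoveredIndex C i (inj₂ j) μ
    ¬CoveredIndex-∩-μ j (Tⱼ∩Tᵢ≢Tᵢ , (μ∈Tⱼ , _)) = Tⱼ∩Tᵢ≢Tᵢ λ τ → mk⇔ proj₂ λ τ∈Tᵢ →
      Tk₁-intro (proj₁ τ∈Tᵢ) (proj₂ minimal τ τ∈Tᵢ (Tk₁-neuron μ∈Tⱼ)) , τ∈Tᵢ

    minimal⇒SameImage-μ-i : (μ - i) ∈C C → SameImage C i μ (μ - i)
    minimal⇒SameImage-μ-i μ-i∈C (inj₁ j) with j ≟ i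
    ... | yes refl = ¬-both⇒⇔ ¬CoveredIndex-own ¬CoveredIndex-own
    ... | no j≢i   = mk⇔ (CoveredIndex-mono μ-i∈C (λ j∈μ → x∈p∧x≢y⇒x∈p-y j∈μ j≢i))
                         (CoveredIndex-mono (proj₁ (proj₁ minimal)) (p─q⊆p μ ⁅ i ⁆))
    minimal⇒SameImage-μ-i μ-i∈C (inj₂ j) =
      ¬-both⇒⇔ (¬CoveredIndex-∩-μ j) (¬CoveredIndex-∩-outside j (x∉p-x μ i))

lemma37 : (n : ℕ) (C : CodeOn n) → IsNeuralCode C → IntersectionComplete C →
          (i : Fin n) → ¬ Redundant C i → ¬ Trivial C i →
          (μ : Subset n) → IsMinimalOfTrunk C i μ →
          ((μ - i) ∈C C) × SameImage C i μ (μ - i)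
lemma37 n C _ closed i ¬redundant _ μ minimal = μ-i∈C , minimal⇒SameImage-μ-i minimal μ-i∈C
  where
  μ-i∈C : (μ - i) ∈C C
  μ-i∈C = ¬redundant⇒μ-i∈C minimal closed ¬redundant
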